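{- Let $D$ be a diagram and $r$ a row index such that the set of columns occupied by row $r$ of $D$ is contained in the set of columns occupied by row $r+1$. Then for every $T\in\mathrm{KD}(D)$ there exists $S\in\mathrm{KD}(s_rD)$ such that: (1) $S$ and $T$ have exactly the same cells in every row $t\neq r,r+1$; (2) if $S$ and $T$ differ (in rows $r,r+1$) in some column $c$, then in column $c$, $T$ has a cell in row $r+1$ but not in row $r$, and $S$ has a cell in row $r$ but not in row $r+1$; (3) if $S$ and $T$ differ in rows $r,r+1$ in column $c$ and agree in rows $r,r+1$ in some column $b<c$, and column $b$ has a cell in row $r$, then column $b$ also has a cell in row $r+1$.
   Context: A diagram is a finite set of cells $(i,j)\in\mathbb{Z}_{>0}^2$ ($i$ row, $j$ column), rows numbered top to bottom. $s_rD$ is $D$ with rows $r,r+1$ exchanged. A Kohnert move selects the rightmost cell of a row and moves it up (toward row 1) within its column to the first empty position above it, jumping over cells, if one exists; $\mathrm{KD}(D)$ is the set of diagrams reachable from $D$ by Kohnert moves (including $D$). "$S$ and $T$ differ in rows $r,r+1$ in column $c$" means the sets of cells of $S$ and of $T$ lying in column $c$ and rows $r,r+1$ are different. -}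

module Defs where

open import Data.Nat using (ℕ; suc; _<_; _≤_; _≟_)
open import Data.Product using (_×_; _,_; ∃; ∃-syntax)
open import Data.Sum using (_⊎_)
open import Data.List using (List; map)
open import Data.List.Membership.Propositional using (_∈_; _∉_)
open import Relation.Binary.PropositionalEquality using (_≡_; _≢_)
open import Relation.Nullary using (¬_; yes; no)
open import Relation.Binary.Construct.Closure.ReflexiveTransitive using (Star)
open import Function.Bundles using (_⇔_)

-- A cell (i , j) : i = row (0 = top row), j = column.
-- Convention: rows/columns are indexed from 0 instead of 1 (harmless shift).
Cell : Set
Cell = ℕ × ℕ

-- A diagram is a finite set of cells, represented by a list; only
-- membership matters (all notions below are membership-based).
Diagram : Set
Diagram = List Cell

swapRow : ℕ → ℕ → ℕ
swapRow r i with i ≟ r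
... | yes _ = suc r
... | no _ with i ≟ suc r
...   | yes _ = r
...   | no _ = i

s : ℕ → Diagram → Diagram
s r D = map (λ { (i , j) → (swapRow r i , j) }) D

Rightmost : Diagram → ℕ → ℕ → Set
Rightmost D r c = ((r , c) ∈ D) × (∀ c' → (r , c') ∈ D → c' ≤ c)

KohnertMove : Diagram → Diagram → Set
KohnertMove D D' =
  ∃[ r ] ∃[ c ] ∃[ r' ]
    ( Rightmost D r c
    × r' < r
    × (r' , c) ∉ D
    × (∀ k → r' < k → k < r → (k , c) ∈ D)
    × (∀ x → (x ∈ D') ⇔ (((x ∈ D) × (x ≢ (r , c))) ⊎ (x ≡ (r' , c)))) )

_∈KD_ : Diagram → Diagram → Set
T ∈KD D = Star KohnertMove D T

AgreeAt : ℕ → Diagram → Diagram → ℕ → Set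
AgreeAt r S T c =
  (((r , c) ∈ S) ⇔ ((r , c) ∈ T)) × (((suc r , c) ∈ S) ⇔ ((suc r , c) ∈ T))

DifferAt : ℕ → Diagram → Diagram → ℕ → Set
DifferAt r S T c = ¬ AgreeAt r S T c

-- Call S and T related when they satisfy (1)–(3); by (2), in a column where they differ S has
-- its cell in row r where T has it in row r+1 (the column is "lifted"). D and s_r D are related
-- because row r of D lies cellwise above row r+1, so it suffices to answer each Kohnert move
-- T ⟶ T' by moves S ⟶* S' with S' related to T'. If the moved column agrees in rows r, r+1, or
-- the move avoids these rows, S makes the same move. Otherwise: if T raises the row-(r+1) cell
-- of a lifted column into row r, S stays; if a cell from below lands in row r of a lifted
-- column, S moves it to row r+1 instead; and if T moves its rightmost row-r cell (r, c) while a
-- lifted column lies right of c, then (3) shows that row r of T lies above row r+1, so S can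
-- first raise all its row-(r+1) cells right of c into row r, after which its cell (r+1, c) is
-- rightmost in its row and follows T's cell.

module Submission where

open import Defs
open import Data.Nat using (ℕ; zero; suc; _<_; _≤_; _⊔_; _≟_; _≤?_; _<?_)
open import Data.Nat.Properties
  using ( 1+n≢n; n<1+n; n≮0; m≤m⊔n; m≤n⊔m; ≤-trans; <-trans; ≤-<-trans; ≤-pred
        ; <⇒≤; <⇒≢; >⇒≢; <⇒≱; ≰⇒>; ≤∧≢⇒<; m≤n⇒m<n∨m≡n )
open import Data.Product using (_×_; _,_; ∃-syntax; proj₁; proj₂)
open import Data.Product.Properties using (≡-dec)
open import Data.Product.Function.NonDependent.Propositional using (_×-⇔_)
open import Data.Sum using (_⊎_; inj₁; inj₂)
open import Data.Sum.Function.Propositional using (_⊎-⇔_)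
open import Data.Empty using (⊥-elim)
open import Data.List using ([]; _∷_; filter)
open import Data.List.Membership.Propositional using (_∈_; _∉_; find; lose)
open import Data.List.Membership.Propositional.Properties using (∈-filter⁺; ∈-filter⁻; ∈-map⁺; ∈-map⁻)
open import Data.List.Relation.Unary.Any using (Any; here; there; any?)
open import Relation.Binary.PropositionalEquality using (_≡_; _≢_; refl; sym; trans; cong; subst; ≢-sym)
open import Relation.Binary.Definitions using (DecidableEquality)
open import Relation.Nullary using (¬_; Dec; yes; no; ¬?)
open import Relation.Nullary.Decidable using (_×-dec_; map′)
open import Relation.Binary.Construct.Closure.ReflexiveTransitive using (ε; _◅_; _◅◅_)
open import Function.Base using (_∘_)
open import Function.Bundles using (_⇔_; mk⇔; Equivalence)
open import Function.Properties.Equivalence using () renaming (refl to ⇔-refl; sym to ⇔-sym; trans to ⇔-trans)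
open import Function.Related.TypeIsomorphisms using (¬-cong-⇔)
open Equivalence using (to; from)

both-⇔ : ∀ {A B : Set} → A → B → A ⇔ B
both-⇔ a b = mk⇔ (λ _ → b) (λ _ → a)

neither-⇔ : ∀ {A B : Set} → ¬ A → ¬ B → A ⇔ B
neither-⇔ ¬a ¬b = mk⇔ (λ a → ⊥-elim (¬a a)) (λ b → ⊥-elim (¬b b))

⇔-dec : ∀ {A B : Set} → Dec A → Dec B → Dec (A ⇔ B)
⇔-dec (yes a) (yes b) = yes (both-⇔ a b)
⇔-dec (yes a) (no ¬b) = no (λ a⇔b → ¬b (to a⇔b a))
⇔-dec (no ¬a) (yes b) = no (λ a⇔b → ¬a (from a⇔b b))
⇔-dec (no ¬a) (no ¬b) = yes (neither-⇔ ¬a ¬b)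

_≟ᶜ_ : DecidableEquality Cell
_≟ᶜ_ = ≡-dec _≟_ _≟_

open import Data.List.Membership.DecPropositional _≟ᶜ_ using (_∈?_)

rowsDiffer : ∀ {i j k l : ℕ} → i ≢ k → (i , j) ≢ (k , l)
rowsDiffer i≢k refl = i≢k refl

columnsDiffer : ∀ {i j k l : ℕ} → j ≢ l → (i , j) ≢ (k , l)
columnsDiffer j≢l refl = j≢l refl

n≢1+n : ∀ {n} → n ≢ suc n
n≢1+n = ≢-sym 1+n≢n

Moved : Diagram → Diagram → Cell → Cell → Set
Moved D D' a b = ∀ x → (x ∈ D') ⇔ (((x ∈ D) × (x ≢ a)) ⊎ (x ≡ b))

module MovedCell {D D' : Diagram} {a b : Cell} (M : Moved D D' a b) where

  kept : ∀ {x} → x ≢ a → x ∈ D → x ∈ D'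
  kept x≢a x∈D = from (M _) (inj₁ (x∈D , x≢a))

  preexisting : ∀ {x} → x ≢ b → x ∈ D' → x ∈ D
  preexisting {x} x≢b x∈D' with to (M x) x∈D'
  ... | inj₁ (x∈D , _) = x∈D
  ... | inj₂ x≡b = ⊥-elim (x≢b x≡b)

  arrived : b ∈ D'
  arrived = from (M b) (inj₂ refl)

  departed : a ≢ b → a ∉ D'
  departed a≢b a∈D' with to (M a) a∈D'
  ... | inj₁ (_ , a≢a) = a≢a refl
  ... | inj₂ a≡b = a≢b a≡b

  unmoved : ∀ {x} → x ≢ a → x ≢ b → (x ∈ D) ⇔ (x ∈ D')
  unmoved x≢a x≢b = mk⇔ (kept x≢a) (preexisting x≢b)

moved-⇔ : ∀ {S S' T T' a b a' b' x} → Moved S S' a b → Moved T T' a' b'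
        → (x ∈ S ⇔ x ∈ T) → (x ≡ a ⇔ x ≡ a') → (x ≡ b ⇔ x ≡ b') → (x ∈ S' ⇔ x ∈ T')
moved-⇔ {x = x} MS MT x∈ a⇔ b⇔ =
  ⇔-trans (MS x) (⇔-trans ((x∈ ×-⇔ ¬-cong-⇔ a⇔) ⊎-⇔ b⇔) (⇔-sym (MT x)))

move : Diagram → Cell → Cell → Diagram
move D a b = b ∷ filter (λ x → ¬? (x ≟ᶜ a)) D

move-Moved : ∀ D a b → Moved D (move D a b) a b
move-Moved D a b x = mk⇔ out into
  where
  out : x ∈ move D a b → ((x ∈ D) × (x ≢ a)) ⊎ (x ≡ b)
  out (here x≡b) = inj₂ x≡b
  out (there x∈) = inj₁ (∈-filter⁻ (λ y → ¬? (y ≟ᶜ a)) x∈)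
  into : ((x ∈ D) × (x ≢ a)) ⊎ (x ≡ b) → x ∈ move D a b
  into (inj₁ (x∈D , x≢a)) = there (∈-filter⁺ (λ y → ¬? (y ≟ᶜ a)) x∈D x≢a)
  into (inj₂ x≡b) = here x≡b

record KohnertStep (D D' : Diagram) (p c p' : ℕ) : Set where
  constructor kohnertStep
  field
    rightmost : Rightmost D p c
    upward    : p' < p
    vacant    : (p' , c) ∉ D
    jumped    : ∀ k → p' < k → k < p → (k , c) ∈ D
    moved     : Moved D D' (p , c) (p' , c)

moveCell : ∀ {D p c p'} → Rightmost D p c → p' < p → (p' , c) ∉ D
         → (∀ k → p' < k → k < p → (k , c) ∈ D) → KohnertMove D (move D (p , c) (p' , c))
moveCell {D} {p} {c} {p'} rm up vac jmp = p , c , p' , rm , up , vac , jmp , move-Moved D (p , c) (p' , c)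

columnBound : ∀ (D : Diagram) → ∃[ N ] (∀ {i j} → (i , j) ∈ D → j < N)
columnBound [] = 0 , λ ()
columnBound ((i , j) ∷ D) with columnBound D
... | N , bounded = suc j ⊔ N , λ
  { (here refl) → m≤m⊔n (suc j) N
  ; (there x) → ≤-trans (bounded x) (m≤n⊔m (suc j) N)
  }

swapRow-self : ∀ r → swapRow r r ≡ suc r
swapRow-self r with r ≟ r
... | yes _ = refl
... | no r≢r = ⊥-elim (r≢r refl)

swapRow-suc : ∀ r → swapRow r (suc r) ≡ r
swapRow-suc r with suc r ≟ r
... | yes 1+r≡r = ⊥-elim (1+n≢n 1+r≡r)
... | no _ with suc r ≟ suc r
...   | yes _ = refl
...   | no 1+r≢1+r = ⊥-elim (1+r≢1+r refl)

swapRow-other : ∀ r {t} → t ≢ r → t ≢ suc r → swapRow r t ≡ t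
swapRow-other r {t} t≢r t≢1+r with t ≟ r
... | yes t≡r = ⊥-elim (t≢r t≡r)
... | no _ with t ≟ suc r
...   | yes t≡1+r = ⊥-elim (t≢1+r t≡1+r)
...   | no _ = refl

swapRow-involutive : ∀ r t → swapRow r (swapRow r t) ≡ t
swapRow-involutive r t = byCases (t ≟ r) (t ≟ suc r)
  where
  byCases : Dec (t ≡ r) → Dec (t ≡ suc r) → swapRow r (swapRow r t) ≡ t
  byCases (yes refl) _ = trans (cong (swapRow t) (swapRow-self t)) (swapRow-suc t)
  byCases (no _) (yes refl) = trans (cong (swapRow r) (swapRow-suc r)) (swapRow-self r)
  byCases (no t≢r) (no t≢1+r) =
    trans (cong (swapRow r) (swapRow-other r t≢r t≢1+r)) (swapRow-other r t≢r t≢1+r)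

∈-s : ∀ r D t c → ((t , c) ∈ s r D) ⇔ ((swapRow r t , c) ∈ D)
∈-s r D t c = mk⇔ out into
  where
  out : (t , c) ∈ s r D → (swapRow r t , c) ∈ D
  out t∈ with ∈-map⁻ _ t∈
  ... | (i , j) , ij∈D , refl = subst (λ z → (z , j) ∈ D) (sym (swapRow-involutive r i)) ij∈D
  into : (swapRow r t , c) ∈ D → (t , c) ∈ s r D
  into t∈ = subst (λ z → (z , c) ∈ s r D) (swapRow-involutive r t) (∈-map⁺ _ t∈)

module _ (r : ℕ) where

  agree-refl : ∀ {S j} → AgreeAt r S S j
  agree-refl = ⇔-refl , ⇔-refl

  agree-sym : ∀ {S T j} → AgreeAt r S T j → AgreeAt r T S j
  agree-sym (upper , lower) = ⇔-sym upper , ⇔-sym lower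

  agree-trans : ∀ {S T U j} → AgreeAt r S T j → AgreeAt r T U j → AgreeAt r S U j
  agree-trans (upper , lower) (upper' , lower') = ⇔-trans upper upper' , ⇔-trans lower lower'

  agree-transport : ∀ {S T S' T' j} → AgreeAt r S S' j → AgreeAt r T T' j
                  → AgreeAt r S T j → AgreeAt r S' T' j
  agree-transport S~S' T~T' S~T = agree-trans (agree-sym S~S') (agree-trans S~T T~T')

  agree? : ∀ S T j → Dec (AgreeAt r S T j)
  agree? S T j = ⇔-dec ((r , j) ∈? S) ((r , j) ∈? T) ×-dec ⇔-dec ((suc r , j) ∈? S) ((suc r , j) ∈? T)

  moved-agree : ∀ {D D' a b j} → Moved D D' a b
              → (r , j) ≢ a → (r , j) ≢ b → (suc r , j) ≢ a → (suc r , j) ≢ b → AgreeAt r D D' j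
  moved-agree M upper≢a upper≢b lower≢a lower≢b = unmoved upper≢a upper≢b , unmoved lower≢a lower≢b
    where open MovedCell M

  moved-agreeOff : ∀ {D D' p p' c j} → Moved D D' (p , c) (p' , c) → j ≢ c → AgreeAt r D D' j
  moved-agreeOff {c = c} {j} M j≢c = moved-agree M off off off off
    where
    off : ∀ {i k} → (i , j) ≢ (k , c)
    off = columnsDiffer j≢c

  record Lifted (S T : Diagram) (c : ℕ) : Set where
    field
      lower∈T : (suc r , c) ∈ T
      upper∉T : (r , c) ∉ T
      upper∈S : (r , c) ∈ S
      lower∉S : (suc r , c) ∉ S

  lifted-transport : ∀ {S T S' T' c} → AgreeAt r S S' c → AgreeAt r T T' c
                   → Lifted S T c → Lifted S' T' c
  lifted-transport (upperS , lowerS) (upperT , lowerT) l = record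
    { lower∈T = to lowerT lower∈T
    ; upper∉T = λ upper∈T' → upper∉T (from upperT upper∈T')
    ; upper∈S = to upperS upper∈S
    ; lower∉S = λ lower∈S' → lower∉S (from lowerS lower∈S')
    }
    where open Lifted l

  SameOutside : Diagram → Diagram → Set
  SameOutside S T = ∀ t c → t ≢ r → t ≢ suc r → ((t , c) ∈ S) ⇔ ((t , c) ∈ T)

  LiftedWhereDiffer : Diagram → Diagram → Set
  LiftedWhereDiffer S T = ∀ c → DifferAt r S T c → Lifted S T c

  LeftClosed : Diagram → Diagram → Set
  LeftClosed S T = ∀ c b → DifferAt r S T c → b < c → AgreeAt r S T b → (r , b) ∈ T → (suc r , b) ∈ T

  record Related (S T : Diagram) : Set where
    field
      sameOutside       : SameOutside S T
      liftedWhereDiffer : LiftedWhereDiffer S T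
      leftClosed        : LeftClosed S T

  agreeOrLifted : ∀ {S T} → LiftedWhereDiffer S T → ∀ c → AgreeAt r S T c ⊎ Lifted S T c
  agreeOrLifted {S} {T} lifted c with agree? S T c
  ... | yes agree = inj₁ agree
  ... | no differ = inj₂ (lifted c differ)

  upper∈T⇒agree : ∀ {S T c} → LiftedWhereDiffer S T → (r , c) ∈ T → AgreeAt r S T c
  upper∈T⇒agree {c = c} lifted upper∈T with agreeOrLifted lifted c
  ... | inj₁ agree = agree
  ... | inj₂ l = ⊥-elim (Lifted.upper∉T l upper∈T)

  lower∈S⇒agree : ∀ {S T c} → LiftedWhereDiffer S T → (suc r , c) ∈ S → AgreeAt r S T c
  lower∈S⇒agree {c = c} lifted lower∈S with agreeOrLifted lifted c
  ... | inj₁ agree = agree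
  ... | inj₂ l = ⊥-elim (Lifted.lower∉S l lower∈S)

  lower∉T⇒agree : ∀ {S T c} → LiftedWhereDiffer S T → (suc r , c) ∉ T → AgreeAt r S T c
  lower∉T⇒agree {c = c} lifted lower∉T with agreeOrLifted lifted c
  ... | inj₁ agree = agree
  ... | inj₂ l = ⊥-elim (lower∉T (Lifted.lower∈T l))

  lower∈S⇒lower∈T : ∀ {S T c} → LiftedWhereDiffer S T → (suc r , c) ∈ S → (suc r , c) ∈ T
  lower∈S⇒lower∈T lifted lower∈S = to (proj₂ (lower∈S⇒agree lifted lower∈S)) lower∈S

  sameColumn : ∀ {S T c} → SameOutside S T → AgreeAt r S T c → ∀ t → ((t , c) ∈ S) ⇔ ((t , c) ∈ T)
  sameColumn {c = c} same (upper , lower) t with t ≟ r | t ≟ suc r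
  ... | yes refl | _ = upper
  ... | no _ | yes refl = lower
  ... | no t≢r | no t≢1+r = same t c t≢r t≢1+r

  related-s : ∀ {D} → (∀ c → (r , c) ∈ D → (suc r , c) ∈ D) → Related (s r D) D
  related-s {D} covered = record
    { sameOutside = λ t c t≢r t≢1+r → swapped c (swapRow-other r t≢r t≢1+r)
    ; liftedWhereDiffer = lifted
    ; leftClosed = λ _ b _ _ _ → covered b
    }
    where
    swapped : ∀ {t t'} c → swapRow r t ≡ t' → ((t , c) ∈ s r D) ⇔ ((t' , c) ∈ D)
    swapped {t} c eq = subst (λ z → ((t , c) ∈ s r D) ⇔ ((z , c) ∈ D)) eq (∈-s r D t c)
    upper-s : ∀ c → ((r , c) ∈ s r D) ⇔ ((suc r , c) ∈ D)
    upper-s c = swapped c (swapRow-self r)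
    lower-s : ∀ c → ((suc r , c) ∈ s r D) ⇔ ((r , c) ∈ D)
    lower-s c = swapped c (swapRow-suc r)
    lifted : LiftedWhereDiffer (s r D) D
    lifted c differ with (r , c) ∈? D | (suc r , c) ∈? D
    ... | yes upper | _ = ⊥-elim (differ
          ( both-⇔ (from (upper-s c) (covered c upper)) upper
          , both-⇔ (from (lower-s c) upper) (covered c upper) ))
    ... | no ¬upper | yes lower = record
          { lower∈T = lower
          ; upper∉T = ¬upper
          ; upper∈S = from (upper-s c) lower
          ; lower∉S = λ lower∈S → ¬upper (to (lower-s c) lower∈S)
          }
    ... | no ¬upper | no ¬lower = ⊥-elim (differ
          ( neither-⇔ (λ upper∈S → ¬lower (to (upper-s c) upper∈S)) ¬upper
          , neither-⇔ (λ lower∈S → ¬upper (to (lower-s c) lower∈S)) ¬lower ))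

  related-transport : ∀ {S T S' T'} → Related S T → SameOutside S' T'
    → (∀ j → AgreeAt r S S' j) → (∀ j → AgreeAt r T T' j) → Related S' T'
  related-transport rel same' S~S' T~T' = record
    { sameOutside = same'
    ; liftedWhereDiffer = λ j differ →
        lifted-transport (S~S' j) (T~T' j) (liftedWhereDiffer j (differ ∘ agree-transport (S~S' j) (T~T' j)))
    ; leftClosed = λ j b differ b<j agree upper∈T' →
        to (proj₂ (T~T' b))
          (leftClosed j b (differ ∘ agree-transport (S~S' j) (T~T' j)) b<j
            (agree-transport (agree-sym (S~S' b)) (agree-sym (T~T' b)) agree) (from (proj₁ (T~T' b)) upper∈T'))
    }
    where open Related rel

  -- A change confined to column c in rows r, r+1; the last three hypotheses are (2) and (3)
  -- where they involve column c.
  related-local : ∀ {S T S' T'} c → Related S T → SameOutside S' T'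
    → (∀ j → j ≢ c → AgreeAt r S S' j) → (∀ j → j ≢ c → AgreeAt r T T' j)
    → (DifferAt r S' T' c → Lifted S' T' c)
    → (∀ j → DifferAt r S T j → c < j → (r , c) ∈ T' → (suc r , c) ∈ T')
    → (DifferAt r S' T' c → ∀ b → b < c → AgreeAt r S T b → (r , b) ∈ T → (suc r , b) ∈ T)
    → Related S' T'
  related-local {S} {T} {S'} {T'} c rel same' S~S' T~T' liftedAtC closedAtC closedLeftOfC = record
    { sameOutside = same' ; liftedWhereDiffer = lifted' ; leftClosed = closed' }
    where
    open Related rel
    differ-before : ∀ {j} → j ≢ c → DifferAt r S' T' j → DifferAt r S T j
    differ-before j≢c differ = differ ∘ agree-transport (S~S' _ j≢c) (T~T' _ j≢c)
    lifted' : LiftedWhereDiffer S' T'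
    lifted' j differ with j ≟ c
    ... | yes refl = liftedAtC differ
    ... | no j≢c =
      lifted-transport (S~S' j j≢c) (T~T' j j≢c) (liftedWhereDiffer j (differ-before j≢c differ))
    closed' : LeftClosed S' T'
    closed' j b differ b<j agree upper∈T' with b ≟ c
    ... | yes refl = closedAtC j (differ-before (>⇒≢ b<j) differ) b<j upper∈T'
    ... | no b≢c = to (proj₂ (T~T' b b≢c)) (closedBefore (j ≟ c))
      where
      agreeBefore : AgreeAt r S T b
      agreeBefore = agree-transport (agree-sym (S~S' b b≢c)) (agree-sym (T~T' b b≢c)) agree
      upper∈T : (r , b) ∈ T
      upper∈T = from (proj₁ (T~T' b b≢c)) upper∈T'
      closedBefore : Dec (j ≡ c) → (suc r , b) ∈ T
      closedBefore (yes refl) = closedLeftOfC differ b b<j agreeBefore upper∈T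
      closedBefore (no j≢c) = leftClosed j b (differ-before j≢c differ) b<j agreeBefore upper∈T

  related-sameMove : ∀ {S T S' T' p c p'} → Related S T → AgreeAt r S T c
    → Moved S S' (p , c) (p' , c) → Moved T T' (p , c) (p' , c)
    → (∀ j → DifferAt r S T j → c < j → (r , c) ∈ T' → (suc r , c) ∈ T')
    → Related S' T'
  related-sameMove {S} {T} {S'} {T'} {c = c} rel (upper , lower) MS MT closedAtC =
    related-local c rel
      (λ t j t≢r t≢1+r → sameMove-⇔ (sameOutside t j t≢r t≢1+r))
      (λ _ → moved-agreeOff MS) (λ _ → moved-agreeOff MT)
      (λ differ → ⊥-elim (differ agreeAfter))
      closedAtC
      (λ differ → ⊥-elim (differ agreeAfter))
    where
    open Related rel
    sameMove-⇔ : ∀ {x} → (x ∈ S ⇔ x ∈ T) → (x ∈ S' ⇔ x ∈ T')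
    sameMove-⇔ x∈ = moved-⇔ MS MT x∈ ⇔-refl ⇔-refl
    agreeAfter : AgreeAt r S' T' c
    agreeAfter = sameMove-⇔ upper , sameMove-⇔ lower

  Matching : Diagram → Diagram → Set
  Matching S T = ∃[ S' ] (S' ∈KD S × Related S' T)

  matching-◅◅ : ∀ {S S₁ T} → S₁ ∈KD S → Matching S₁ T → Matching S T
  matching-◅◅ S₁∈KD (S' , S'∈KD , rel) = S' , S₁∈KD ◅◅ S'∈KD , rel

  differsRightOf? : ∀ {S T} → LiftedWhereDiffer S T → ∀ c → Dec (∃[ m ] (c < m × DifferAt r S T m))
  differsRightOf? {S} {T} lifted c =
    map′ witness (λ (m , c<m , differ) → lose (Lifted.upper∈S (lifted m differ)) (c<m , differ))
      (any? (λ x → (c <? proj₂ x) ×-dec ¬? (agree? S T (proj₂ x))) S)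
    where
    witness : Any (λ x → c < proj₂ x × DifferAt r S T (proj₂ x)) S → ∃[ m ] (c < m × DifferAt r S T m)
    witness found with find found
    ... | (_ , m) , _ , c<m , differ = m , c<m , differ

  liftLower-preserves : ∀ {S S' T n} → SameOutside S T → LiftedWhereDiffer S T → (suc r , n) ∈ S → (r , n) ∉ T
    → Moved S S' (suc r , n) (r , n) → SameOutside S' T × LiftedWhereDiffer S' T
  liftLower-preserves {S} {S'} {T} {n} same lifted lower∈S upper∉T M =
    (λ t j t≢r t≢1+r →
       ⇔-trans (⇔-sym (unmoved (rowsDiffer t≢1+r) (rowsDiffer t≢r))) (same t j t≢r t≢1+r))
    , lifted'
    where
    open MovedCell M
    lifted' : LiftedWhereDiffer S' T
    lifted' j differ with j ≟ n
    ... | yes refl = record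
          { lower∈T = lower∈S⇒lower∈T lifted lower∈S
          ; upper∉T = upper∉T
          ; upper∈S = arrived
          ; lower∉S = departed (rowsDiffer 1+n≢n)
          }
    ... | no j≢n = lifted-transport (moved-agreeOff M j≢n) agree-refl
                     (lifted j (differ ∘ agree-transport (moved-agreeOff M j≢n) agree-refl))

  LowerRowCleared : ℕ → Diagram → Diagram → Set
  LowerRowCleared c S T =
    ∃[ S' ] ( S' ∈KD S × SameOutside S' T × LiftedWhereDiffer S' T
            × (∀ t → ((t , c) ∈ S') ⇔ ((t , c) ∈ S)) × (∀ j → (suc r , j) ∈ S' → j ≤ c) )

  cleared-◅ : ∀ {c S S₁ T} → KohnertMove S S₁ → (∀ t → ((t , c) ∈ S₁) ⇔ ((t , c) ∈ S))
            → LowerRowCleared c S₁ T → LowerRowCleared c S T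
  cleared-◅ S→S₁ column₁ (S' , S'∈KD , same' , lifted' , column' , lowerMax) =
    S' , S→S₁ ◅ S'∈KD , same' , lifted' , (λ t → ⇔-trans (column' t) (column₁ t)) , lowerMax

  -- Raises the row-(r+1) cells of S right of column c, from right to left so that each is the
  -- rightmost of its row when it moves; n bounds their columns.
  clearLowerRow : ∀ {T} c → (∀ j → (r , j) ∈ T → j ≤ c)
    → ∀ n S → SameOutside S T → LiftedWhereDiffer S T → (∀ j → (suc r , j) ∈ S → c < j → j < n)
    → LowerRowCleared c S T
  clearLowerRow c upperMax zero S same lifted bound =
    S , ε , same , lifted , (λ _ → ⇔-refl) , bounded
    where
    bounded : ∀ j → (suc r , j) ∈ S → j ≤ c
    bounded j x with j ≤? c
    ... | yes j≤c = j≤c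
    ... | no j≰c = ⊥-elim (n≮0 (bound j x (≰⇒> j≰c)))
  clearLowerRow {T} c upperMax (suc n) S same lifted bound with ((suc r , n) ∈? S) ×-dec (c <? n)
  ... | no ¬lowerRight = clearLowerRow c upperMax n S same lifted bound'
    where
    bound' : ∀ j → (suc r , j) ∈ S → c < j → j < n
    bound' j x c<j = ≤∧≢⇒< (≤-pred (bound j x c<j)) (λ { refl → ¬lowerRight (x , c<j) })
  ... | yes (lower∈S , c<n) =
    cleared-◅ liftCell (λ _ → ⇔-sym (unmoved (columnsDiffer c≢n) (columnsDiffer c≢n)))
      (clearLowerRow c upperMax n S₁ (proj₁ related₁) (proj₂ related₁) bound₁)
    where
    S₁ : Diagram
    S₁ = move S (suc r , n) (r , n)
    M : Moved S S₁ (suc r , n) (r , n)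
    M = move-Moved S (suc r , n) (r , n)
    open MovedCell M
    c≢n : c ≢ n
    c≢n = <⇒≢ c<n
    upper∉T : (r , n) ∉ T
    upper∉T x = <⇒≱ c<n (upperMax n x)
    related₁ : SameOutside S₁ T × LiftedWhereDiffer S₁ T
    related₁ = liftLower-preserves same lifted lower∈S upper∉T M
    bound₁ : ∀ j → (suc r , j) ∈ S₁ → c < j → j < n
    bound₁ j x c<j = ≤∧≢⇒< (≤-pred (bound j (preexisting (rowsDiffer 1+n≢n) x) c<j))
                           (λ { refl → departed (rowsDiffer 1+n≢n) x })
    lowerMax : ∀ j → (suc r , j) ∈ S → j ≤ n
    lowerMax j x with j ≤? c
    ... | yes j≤c = ≤-trans j≤c (<⇒≤ c<n)
    ... | no j≰c = ≤-pred (bound j x (≰⇒> j≰c))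
    upper∉S : (r , n) ∉ S
    upper∉S x = upper∉T (to (proj₁ (lower∈S⇒agree lifted lower∈S)) x)
    liftCell : KohnertMove S S₁
    liftCell = moveCell (lower∈S , lowerMax) (n<1+n r) upper∉S
                 (λ k r<k k<1+r → ⊥-elim (<⇒≱ r<k (≤-pred k<1+r)))

  follow-fromLower : ∀ {S T T' c p'} → Related S T → KohnertStep T T' r c p'
    → (∀ t → ((t , c) ∈ S) ⇔ ((t , c) ∈ T)) → (∀ j → (suc r , j) ∈ S → j ≤ c)
    → (∀ b → (r , b) ∈ T → (suc r , b) ∈ T) → Matching S T'
  follow-fromLower {S} {T} {T'} {c} {p'} rel m column lowerMax covered =
    move S (suc r , c) (p' , c)
    , moveCell (from (column (suc r)) lower∈T , lowerMax) p'<1+r (vacant ∘ to (column p')) jumpedS ◅ ε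
    , related-local c rel
        (λ t j t≢r t≢1+r → moved-⇔ MS moved (sameOutside t j t≢r t≢1+r)
                              (neither-⇔ (rowsDiffer t≢1+r) (rowsDiffer t≢r)) ⇔-refl)
        (λ _ → moved-agreeOff MS) (λ _ → moved-agreeOff moved)
        (λ _ → record
           { lower∈T = MovedCell.kept moved (rowsDiffer 1+n≢n) lower∈T
           ; upper∉T = upper∉T'
           ; upper∈S = MovedCell.kept MS (rowsDiffer n≢1+n) (from (column r) upper∈T)
           ; lower∉S = MovedCell.departed MS (rowsDiffer (>⇒≢ p'<1+r))
           })
        (λ _ _ _ upper∈T' → ⊥-elim (upper∉T' upper∈T'))
        (λ _ b _ _ → covered b)
    where
    open Related rel
    open KohnertStep m
    MS : Moved S (move S (suc r , c) (p' , c)) (suc r , c) (p' , c)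
    MS = move-Moved S (suc r , c) (p' , c)
    upper∈T : (r , c) ∈ T
    upper∈T = proj₁ rightmost
    lower∈T : (suc r , c) ∈ T
    lower∈T = covered c upper∈T
    upper∉T' : (r , c) ∉ T'
    upper∉T' = MovedCell.departed moved (rowsDiffer (>⇒≢ upward))
    p'<1+r : p' < suc r
    p'<1+r = <-trans upward (n<1+n r)
    jumpedS : ∀ k → p' < k → k < suc r → (k , c) ∈ S
    jumpedS k p'<k k<1+r with k ≟ r
    ... | yes refl = from (column r) upper∈T
    ... | no k≢r = from (column k) (jumped k p'<k (≤∧≢⇒< (≤-pred k<1+r) k≢r))

  module _ {S T : Diagram} (rel : Related S T) where
    open Related rel

    follow-agreeing : ∀ {T' p c p'} → KohnertStep T T' p c p' → AgreeAt r S T c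
      → (∀ j → (p , j) ∈ S → j ≤ c)
      → (∀ j → DifferAt r S T j → c < j → (r , c) ∈ T' → (suc r , c) ∈ T')
      → Matching S T'
    follow-agreeing {p = p} {c} {p'} m agree rowMax closedAtC =
      move S (p , c) (p' , c)
      , moveCell (from (column p) (proj₁ rightmost) , rowMax) upward (vacant ∘ to (column p'))
          (λ k p'<k k<p → from (column k) (jumped k p'<k k<p)) ◅ ε
      , related-sameMove rel agree (move-Moved S (p , c) (p' , c)) moved closedAtC
      where
      open KohnertStep m
      column : ∀ t → ((t , c) ∈ S) ⇔ ((t , c) ∈ T)
      column = sameColumn sameOutside agree

    follow-outside : ∀ {T' p c p'} → KohnertStep T T' p c p'
      → p ≢ r → p ≢ suc r → p' ≢ r → p' ≢ suc r → Matching S T'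
    follow-outside {p = p} {c} {p'} m p≢r p≢1+r p'≢r p'≢1+r =
      move S (p , c) (p' , c)
      , moveCell (from (row p≢r p≢1+r) (proj₁ rightmost) ,
                  λ j x → proj₂ rightmost j (to (row p≢r p≢1+r) x))
          upward (vacant ∘ to (row p'≢r p'≢1+r)) jumpedS ◅ ε
      , related-transport rel
          (λ t j t≢r t≢1+r → moved-⇔ MS moved (sameOutside t j t≢r t≢1+r) ⇔-refl ⇔-refl)
          (unchanged MS) (unchanged moved)
      where
      open KohnertStep m
      MS : Moved S (move S (p , c) (p' , c)) (p , c) (p' , c)
      MS = move-Moved S (p , c) (p' , c)
      row : ∀ {t j} → t ≢ r → t ≢ suc r → ((t , j) ∈ S) ⇔ ((t , j) ∈ T)
      row t≢r t≢1+r = sameOutside _ _ t≢r t≢1+r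
      unchanged : ∀ {D D'} → Moved D D' (p , c) (p' , c) → ∀ j → AgreeAt r D D' j
      unchanged M j = moved-agree M (rowsDiffer (≢-sym p≢r)) (rowsDiffer (≢-sym p'≢r))
                                    (rowsDiffer (≢-sym p≢1+r)) (rowsDiffer (≢-sym p'≢1+r))
      jumpedS : ∀ k → p' < k → k < p → (k , c) ∈ S
      jumpedS k p'<k k<p with agreeOrLifted liftedWhereDiffer c | k ≟ r | k ≟ suc r
      ... | inj₁ agree | _ | _ = from (sameColumn sameOutside agree k) (jumped k p'<k k<p)
      ... | inj₂ lifted | yes refl | _ = Lifted.upper∈S lifted
      ... | inj₂ lifted | no _ | yes refl =
            ⊥-elim (Lifted.upper∉T lifted (jumped r (≤∧≢⇒< (≤-pred p'<k) p'≢r) (<-trans (n<1+n r) k<p)))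
      ... | inj₂ _ | no k≢r | no k≢1+r = from (row k≢r k≢1+r) (jumped k p'<k k<p)

    stay-lifted : ∀ {T' c p'} → KohnertStep T T' (suc r) c p' → Lifted S T c → Related S T'
    stay-lifted {T'} {c} {p'} m lifted with m≤n⇒m<n∨m≡n (≤-pred (KohnertStep.upward m))
    ... | inj₁ p'<r = ⊥-elim (Lifted.upper∉T lifted (KohnertStep.jumped m r p'<r (n<1+n r)))
    ... | inj₂ refl =
      related-local c rel
        (λ t j t≢r t≢1+r →
           ⇔-trans (sameOutside t j t≢r t≢1+r) (unmoved (rowsDiffer t≢1+r) (rowsDiffer t≢r)))
        (λ _ _ → agree-refl) (λ _ → moved-agreeOff moved)
        (λ differ → ⊥-elim (differ agreeAfter))
        (λ j differ c<j _ →
           ⊥-elim (<⇒≱ c<j (proj₂ rightmost j (Lifted.lower∈T (liftedWhereDiffer j differ)))))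
        (λ differ → ⊥-elim (differ agreeAfter))
      where
      open KohnertStep m
      open MovedCell moved
      agreeAfter : AgreeAt r S T' c
      agreeAfter = both-⇔ (Lifted.upper∈S lifted) arrived
                 , neither-⇔ (Lifted.lower∉S lifted) (departed (rowsDiffer 1+n≢n))

    redirect-fromBelow : ∀ {T' p c} → KohnertStep T T' p c r → p ≢ suc r → Lifted S T c → Matching S T'
    redirect-fromBelow {T'} {p} {c} m p≢1+r lifted =
      move S (p , c) (suc r , c)
      , moveCell (from (row p 1+r<p) (proj₁ rightmost) , (λ j x → proj₂ rightmost j (to (row p 1+r<p) x)))
          1+r<p lower∉S jumpedS ◅ ε
      , related-local c rel
          (λ t j t≢r t≢1+r → moved-⇔ MS moved (sameOutside t j t≢r t≢1+r) ⇔-refl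
                                (neither-⇔ (rowsDiffer t≢1+r) (rowsDiffer t≢r)))
          (λ _ → moved-agreeOff MS) (λ _ → moved-agreeOff moved)
          (λ differ → ⊥-elim (differ agreeAfter))
          (λ _ _ _ _ → lower∈T')
          (λ differ → ⊥-elim (differ agreeAfter))
      where
      open KohnertStep m
      open Lifted lifted
      MS : Moved S (move S (p , c) (suc r , c)) (p , c) (suc r , c)
      MS = move-Moved S (p , c) (suc r , c)
      1+r<p : suc r < p
      1+r<p = ≤∧≢⇒< upward (≢-sym p≢1+r)
      row : ∀ {j} t → suc r < t → ((t , j) ∈ S) ⇔ ((t , j) ∈ T)
      row t 1+r<t = sameOutside t _ (>⇒≢ (<-trans (n<1+n r) 1+r<t)) (>⇒≢ 1+r<t)
      jumpedS : ∀ k → suc r < k → k < p → (k , c) ∈ S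
      jumpedS k 1+r<k k<p = from (row k 1+r<k) (jumped k (<-trans (n<1+n r) 1+r<k) k<p)
      lower∈T' : (suc r , c) ∈ T'
      lower∈T' = MovedCell.kept moved (rowsDiffer (<⇒≢ 1+r<p)) lower∈T
      agreeAfter : AgreeAt r (move S (p , c) (suc r , c)) T' c
      agreeAfter = both-⇔ (MovedCell.kept MS (rowsDiffer (<⇒≢ upward)) upper∈S) (MovedCell.arrived moved)
                 , both-⇔ (MovedCell.arrived MS) lower∈T'

    rowCovered : ∀ {T' c p'} → KohnertStep T T' r c p' → ∀ d → c < d → DifferAt r S T d
               → ∀ b → (r , b) ∈ T → (suc r , b) ∈ T
    rowCovered m d c<d differs b upper∈T =
      leftClosed d b differs (≤-<-trans (proj₂ (KohnertStep.rightmost m) b upper∈T) c<d)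
        (upper∈T⇒agree liftedWhereDiffer upper∈T) upper∈T

    clearThenFollow : ∀ {T' c p'} → KohnertStep T T' r c p'
                    → ∀ d → c < d → DifferAt r S T d → Matching S T'
    clearThenFollow {c = c} m d c<d differs
      with clearLowerRow c (proj₂ rightmost) (proj₁ (columnBound S)) S sameOutside liftedWhereDiffer
             (λ j x _ → proj₂ (columnBound S) x)
      where open KohnertStep m
    ... | S₂ , S₂∈KD , same₂ , lifted₂ , columnKept , lowerMax =
      matching-◅◅ S₂∈KD (follow-fromLower rel₂ m column lowerMax covered)
      where
      covered : ∀ b → (r , b) ∈ T → (suc r , b) ∈ T
      covered = rowCovered m d c<d differs
      rel₂ : Related S₂ T
      rel₂ = record
        { sameOutside = same₂ ; liftedWhereDiffer = lifted₂ ; leftClosed = λ _ b _ _ _ → covered b }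
      column : ∀ t → ((t , c) ∈ S₂) ⇔ ((t , c) ∈ T)
      column t =
        ⇔-trans (columnKept t)
          (sameColumn sameOutside (upper∈T⇒agree liftedWhereDiffer (proj₁ (KohnertStep.rightmost m))) t)

    step-lower : ∀ {T' c p'} → KohnertStep T T' (suc r) c p' → Matching S T'
    step-lower {c = c} m with agreeOrLifted liftedWhereDiffer c
    ... | inj₁ agree =
      follow-agreeing m agree (λ j x → lowerMax j (lower∈S⇒lower∈T liftedWhereDiffer x))
        (λ j differ c<j _ → ⊥-elim (<⇒≱ c<j (lowerMax j (Lifted.lower∈T (liftedWhereDiffer j differ)))))
      where
      lowerMax : ∀ j → (suc r , j) ∈ T → j ≤ c
      lowerMax = proj₂ (KohnertStep.rightmost m)
    ... | inj₂ lifted = S , ε , stay-lifted m lifted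

    step-upper : ∀ {T' c p'} → KohnertStep T T' r c p' → Matching S T'
    step-upper {c = c} m with differsRightOf? liftedWhereDiffer c
    ... | yes (d , c<d , differs) = clearThenFollow m d c<d differs
    ... | no noneRight =
      follow-agreeing m (upper∈T⇒agree liftedWhereDiffer (proj₁ rightmost)) upperMaxS
        (λ j differ c<j _ → ⊥-elim (noneRight (j , c<j , differ)))
      where
      open KohnertStep m
      upperMaxS : ∀ j → (r , j) ∈ S → j ≤ c
      upperMaxS j x with j ≤? c
      ... | yes j≤c = j≤c
      ... | no j≰c with agree? S T j
      ...   | yes agree = proj₂ rightmost j (to (proj₁ agree) x)
      ...   | no differ = ⊥-elim (noneRight (j , ≰⇒> j≰c , differ))

    farRowMax : ∀ {T' p c p'} → KohnertStep T T' p c p' → p ≢ r → p ≢ suc r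
              → ∀ j → (p , j) ∈ S → j ≤ c
    farRowMax m p≢r p≢1+r j x = proj₂ (KohnertStep.rightmost m) j (to (sameOutside _ j p≢r p≢1+r) x)

    step-far : ∀ {T' p c p'} → KohnertStep T T' p c p' → p ≢ r → p ≢ suc r → Matching S T'
    step-far {T'} {p} {c} {p'} m p≢r p≢1+r with p' ≟ r | p' ≟ suc r
    ... | no p'≢r | no p'≢1+r = follow-outside m p≢r p≢1+r p'≢r p'≢1+r
    ... | no _ | yes refl =
      follow-agreeing m (lower∉T⇒agree liftedWhereDiffer (KohnertStep.vacant m)) (farRowMax m p≢r p≢1+r)
        (λ _ _ _ _ → MovedCell.arrived (KohnertStep.moved m))
    ... | yes refl | _ with agreeOrLifted liftedWhereDiffer c
    ...   | inj₂ lifted = redirect-fromBelow m p≢1+r lifted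
    ...   | inj₁ agree = follow-agreeing m agree (farRowMax m p≢r p≢1+r) (λ _ _ _ _ → lower∈T')
      where
      open KohnertStep m
      lower∈T' : (suc r , c) ∈ T'
      lower∈T' = MovedCell.kept moved (rowsDiffer (≢-sym p≢1+r))
                   (jumped (suc r) (n<1+n r) (≤∧≢⇒< upward (≢-sym p≢1+r)))

    step : ∀ {T'} → KohnertMove T T' → Matching S T'
    step {T'} (p , c , p' , rm , up , vac , jmp , mv) = stepAt (kohnertStep rm up vac jmp mv)
      where
      stepAt : KohnertStep T T' p c p' → Matching S T'
      stepAt m with p ≟ suc r | p ≟ r
      ... | yes refl | _ = step-lower m
      ... | no _ | yes refl = step-upper m
      ... | no p≢1+r | no p≢r = step-far m p≢r p≢1+r

  simulate : ∀ {S₀ T₀ T} → Related S₀ T₀ → T ∈KD T₀ → Matching S₀ T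
  simulate rel ε = _ , ε , rel
  simulate rel (mv ◅ mvs) with step rel mv
  ... | S₁ , S₁∈KD , rel₁ = matching-◅◅ S₁∈KD (simulate rel₁ mvs)

lemma3p14 : (D : Diagram) (r : ℕ)
    → (∀ c → (r , c) ∈ D → (suc r , c) ∈ D)
    → ∀ T → T ∈KD D
    → ∃[ S ] ( S ∈KD s r D
      × (∀ t c → t ≢ r → t ≢ suc r → ((t , c) ∈ S) ⇔ ((t , c) ∈ T))
      × (∀ c → DifferAt r S T c
           → ((suc r , c) ∈ T) × ((r , c) ∉ T) × ((r , c) ∈ S) × ((suc r , c) ∉ S))
      × (∀ c b → DifferAt r S T c → b < c → AgreeAt r S T b
           → (r , b) ∈ T → (suc r , b) ∈ T) )
lemma3p14 D r covered T T∈KD with simulate r (related-s r covered) T∈KD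
... | S , S∈KD , rel = S , S∈KD , sameOutside , lifted , leftClosed
  where
  open Related rel
  lifted : ∀ c → DifferAt r S T c → ((suc r , c) ∈ T) × ((r , c) ∉ T) × ((r , c) ∈ S) × ((suc r , c) ∉ S)
  lifted c differ = lower∈T , upper∉T , upper∈S , lower∉S
    where open Lifted (liftedWhereDiffer c differ)
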